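{- Let $(X,\Sigma)$ be an acyclic implicational base and $x\in X$. For every $M\in\mathrm{irr}(x)$ there exist a minimal transversal $T$ of $\mathcal{H}_x$ and an irreducible selection $\mathcal{S}\in\mathcal{S}(T)$ such that $M=\left(\bigcap\mathcal{S}\right)\setminus\{x\}$.
   Context: An implicational base $(X,\Sigma)$ is a set of implications $A\to B$ with $A,B\subseteq X$ disjoint; its closed sets are the $C\subseteq X$ with $A\subseteq C\Rightarrow B\subseteq C$ for all $A\to B\in\Sigma$. It is acyclic if the digraph on $X$ with arcs $ab$ ($a\in A,b\in B$, $A\to B\in\Sigma$) is acyclic. For $y\in X$, $\mathrm{irr}(y)$ is the family of inclusion-maximal closed sets not containing $y$. $\mathcal{H}_x$ is the hypergraph with edge set $\mathcal{E}_x=\{A: A\to B\in\Sigma,\ x\in B\}$ on vertex set $\bigcup\mathcal{E}_x$; a minimal transversal is an inclusion-minimal vertex set meeting every edge. For $T\subseteq X$, an irreducible selection for $T$ is a family obtained by choosing, for each $t\in T$, one set $M_t\in\mathrm{irr}(t)$; $\mathcal{S}(T)$ is the set of all such families. The intersection of the empty family is taken to be $X$. -}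

module Defs where

open import Data.Nat using (ℕ)
open import Data.Fin using (Fin)
open import Data.Fin.Subset using (Subset; _∈_; _∉_; _⊆_)
open import Data.List using (List)
open import Data.List.Membership.Propositional using () renaming (_∈_ to _∈ₗ_)
open import Data.Product using (_×_; _,_; ∃; ∃-syntax)
open import Relation.Nullary using (¬_)
open import Relation.Binary.PropositionalEquality using (_≢_)
open import Relation.Binary.Construct.Closure.Transitive using (TransClosure)

Implication : ℕ → Set
Implication n = Subset n × Subset n

Base : ℕ → Set
Base n = List (Implication n)

Disjoint : ∀ {n} → Subset n → Subset n → Set
Disjoint A B = ∀ z → z ∈ A → z ∉ B

IsImplicationalBase : ∀ {n} → Base n → Set
IsImplicationalBase Σ' = ∀ A B → (A , B) ∈ₗ Σ' → Disjoint A B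

Closed : ∀ {n} → Base n → Subset n → Set
Closed Σ' C = ∀ A B → (A , B) ∈ₗ Σ' → A ⊆ C → B ⊆ C

-- implication digraph and acyclicity (no directed cycle = no nonempty path a ⇝ a)
Arc : ∀ {n} → Base n → Fin n → Fin n → Set
Arc Σ' a b = ∃[ A ] ∃[ B ] ((A , B) ∈ₗ Σ' × a ∈ A × b ∈ B)

Acyclic : ∀ {n} → Base n → Set
Acyclic Σ' = ∀ a → ¬ TransClosure (Arc Σ') a a

Irr : ∀ {n} → Base n → Fin n → Subset n → Set
Irr Σ' y M =
  Closed Σ' M × y ∉ M ×
  (∀ C → Closed Σ' C → y ∉ C → M ⊆ C → C ⊆ M)

Edge : ∀ {n} → Base n → Fin n → Subset n → Set
Edge Σ' x A = ∃[ B ] ((A , B) ∈ₗ Σ' × x ∈ B)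

Vertex : ∀ {n} → Base n → Fin n → Fin n → Set
Vertex Σ' x v = ∃[ A ] (Edge Σ' x A × v ∈ A)

Transversal : ∀ {n} → Base n → Fin n → Subset n → Set
Transversal Σ' x T =
  (∀ v → v ∈ T → Vertex Σ' x v) ×
  (∀ A → Edge Σ' x A → ∃[ t ] (t ∈ T × t ∈ A))

MinimalTransversal : ∀ {n} → Base n → Fin n → Subset n → Set
MinimalTransversal Σ' x T =
  Transversal Σ' x T × (∀ T′ → T′ ⊆ T → Transversal Σ' x T′ → T ⊆ T′)

Selection : ∀ {n} → Subset n → Set
Selection {n} T = (t : Fin n) → t ∈ T → Subset n

IrreducibleSelection : ∀ {n} → Base n → (T : Subset n) → Selection T → Set
IrreducibleSelection Σ' T S = ∀ t (t∈T : t ∈ T) → Irr Σ' t (S t t∈T)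

-- z ∈ ⋂ S  (the empty family intersects to X)
InIntersection : ∀ {n} {T : Subset n} → Selection T → Fin n → Set
InIntersection {T = T} S z = ∀ t (t∈T : t ∈ T) → z ∈ S t t∈T

-- Choose T minimal among the transversals of H_x avoiding M; such transversals exist because
-- every premise A of an implication A → B with x ∈ B meets the complement of the closed set M.
-- Each t ∈ T lies outside M, so M extends to some M_t ∈ irr(t). The set C = (⋂ M_t) ∖ {x} is
-- closed: if A ⊆ C and A → B then B ⊆ M_t for all t, and x ∉ B since otherwise A is an edge,
-- hence meets T in some t with t ∈ A ⊆ M_t. As M ⊆ C and x ∉ C, maximality of M gives C = M.
module Submission where

open import Defs
open import Data.Nat using (ℕ)
open import Data.Fin using (Fin; _≟_)
open import Data.Fin.Subset using (Subset; _∈_; _∉_; _⊆_; _⊂_)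
open import Data.Fin.Subset.Properties using (_∈?_; _⊆?_; _⊂?_; anySubset?; ⊆-trans; p⊂q⇒p⊆q)
open import Data.Fin.Subset.Induction using (⊂-wellFounded; ⊃-wellFounded)
open import Data.Fin.Properties using (any?; all?)
open import Data.Vec using (tabulate)
open import Data.Vec.Properties using (lookup∘tabulate; lookup⇒[]=; []=⇒lookup)
open import Data.List.Membership.Propositional using (find; lose)
import Data.List.Relation.Unary.All as All
import Data.List.Relation.Unary.Any as Any
open import Data.Product using (_×_; _,_; proj₁; proj₂; ∃-syntax; Σ-syntax)
open import Function using (id)
open import Function.Bundles using (_⇔_; mk⇔; module Equivalence)
open import Function.Construct.Composition using (_⇔-∘_)
open import Level using (Level)
open import Relation.Nullary using (Dec; yes; no; does; ¬_; contradiction)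
open import Relation.Nullary.Decidable using (_×-dec_; _→-dec_; ¬?; map′; dec-true)
open import Relation.Unary using (Pred; Decidable)
open import Relation.Binary.PropositionalEquality using (_≢_; refl; trans; sym)
open import Induction.WellFounded using (Acc; acc)

private
  variable
    ℓ : Level
    n : ℕ

comprehension : {P : Pred (Fin n) ℓ} → Decidable P → Subset n
comprehension P? = tabulate (λ i → does (P? i))

module _ {P : Pred (Fin n) ℓ} (P? : Decidable P) where

  ∈-comprehension⁺ : ∀ {i} → P i → i ∈ comprehension P?
  ∈-comprehension⁺ {i} p = lookup⇒[]= i _ (trans (lookup∘tabulate _ i) (dec-true (P? i) p))

  ∈-comprehension⁻ : ∀ {i} → i ∈ comprehension P? → P i
  ∈-comprehension⁻ {i} i∈ with P? i | trans (sym (lookup∘tabulate _ i)) ([]=⇒lookup i∈)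
  ... | yes p | _ = p
  ... | no _  | ()

¬⊂⇒⊇ : {p q : Subset n} → p ⊆ q → ¬ (p ⊂ q) → q ⊆ p
¬⊂⇒⊇ {p = p} p⊆q p⊄q {y} y∈q with y ∈? p
... | yes y∈p = y∈p
... | no  y∉p = contradiction ((λ {z} → p⊆q {z}) , y , y∈q , y∉p) p⊄q

Maximal : Pred (Subset n) ℓ → Pred (Subset n) ℓ
Maximal P C = P C × (∀ D → P D → C ⊆ D → D ⊆ C)

Minimal : Pred (Subset n) ℓ → Pred (Subset n) ℓ
Minimal P C = P C × (∀ D → D ⊆ C → P D → C ⊆ D)

module _ {P : Pred (Subset n) ℓ} (P? : Decidable P) where

  maximal-⊇ : ∀ {M} → P M → ∃[ C ] (M ⊆ C × Maximal P C)
  maximal-⊇ = go (⊃-wellFounded _)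
    where
    go : ∀ {M} → Acc (λ C D → D ⊂ C) M → P M → ∃[ C ] (M ⊆ C × Maximal P C)
    go {M} (acc larger) pM with anySubset? (λ D → P? D ×-dec M ⊂? D)
    ... | yes (D , pD , M⊂D) =
      let C , D⊆C , maxC = go (larger M⊂D) pD in C , ⊆-trans (p⊂q⇒p⊆q M⊂D) D⊆C , maxC
    ... | no ∄larger = M , id , pM , λ D pD M⊆D → ¬⊂⇒⊇ M⊆D (λ M⊂D → ∄larger (D , pD , M⊂D))

  minimal-⊆ : ∀ {M} → P M → ∃[ C ] (C ⊆ M × Minimal P C)
  minimal-⊆ = go (⊂-wellFounded _)
    where
    go : ∀ {M} → Acc _⊂_ M → P M → ∃[ C ] (C ⊆ M × Minimal P C)
    go {M} (acc smaller) pM with anySubset? (λ D → P? D ×-dec D ⊂? M)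
    ... | yes (D , pD , D⊂M) =
      let C , C⊆D , minC = go (smaller D⊂M) pD in C , ⊆-trans C⊆D (p⊂q⇒p⊆q D⊂M) , minC
    ... | no ∄smaller = M , id , pM , λ D D⊆M pD → ¬⊂⇒⊇ D⊆M (λ D⊂M → ∄smaller (D , pD , D⊂M))

disjoint? : (A B : Subset n) → Dec (Disjoint A B)
disjoint? A B = all? (λ z → z ∈? A →-dec ¬? (z ∈? B))

module _ (Σ' : Base n) where

  closed? : Decidable (Closed Σ')
  closed? C = map′ (λ all A B m → All.lookup all m) (λ cl → All.tabulate (λ m → cl _ _ m))
    (All.all? (λ (A , B) → A ⊆? C →-dec B ⊆? C) Σ')

  irr-⊇ : ∀ {t M} → Closed Σ' M → t ∉ M → ∃[ C ] (M ⊆ C × Irr Σ' t C)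
  irr-⊇ {t} M-closed t∉M =
    let C , M⊆C , (C-closed , t∉C) , maxC =
          maximal-⊇ (λ C → closed? C ×-dec ¬? (t ∈? C)) (M-closed , t∉M)
    in C , M⊆C , C-closed , t∉C , λ D D-closed t∉D → maxC D (D-closed , t∉D)

  module _ {M} (M-closed : Closed Σ' M) where

    -- For t ∈ M there is no M_t; M is returned as a junk value.
    irrAbove : Fin n → Subset n
    irrAbove t with t ∈? M
    ... | yes _   = M
    ... | no  t∉M = proj₁ (irr-⊇ M-closed t∉M)

    ⊆-irrAbove : ∀ t → M ⊆ irrAbove t
    ⊆-irrAbove t with t ∈? M
    ... | yes _   = id
    ... | no  t∉M = proj₁ (proj₂ (irr-⊇ M-closed t∉M))

    irrAbove-irr : ∀ {t} → t ∉ M → Irr Σ' t (irrAbove t)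
    irrAbove-irr {t} t∉M with t ∈? M
    ... | yes t∈M  = contradiction t∈M t∉M
    ... | no  t∉M′ = proj₂ (proj₂ (irr-⊇ M-closed t∉M′))

  module _ (x : Fin n) where

    vertex? : Decidable (Vertex Σ' x)
    vertex? v = map′ fromAny (λ (A , (B , m , x∈B) , v∈A) → lose m (x∈B , v∈A))
      (Any.any? (λ (A , B) → x ∈? B ×-dec v ∈? A) Σ')
      where
      fromAny : Any.Any (λ (A , B) → x ∈ B × v ∈ A) Σ' → Vertex Σ' x v
      fromAny any = let (A , B) , m , x∈B , v∈A = find any in A , (B , m , x∈B) , v∈A

    transversal? : Decidable (Transversal Σ' x)
    transversal? T = all? (λ v → v ∈? T →-dec vertex? v) ×-dec map′
      (λ all A (B , m , x∈B) → All.lookup all m x∈B)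
      (λ meets → All.tabulate (λ m x∈B → meets _ (_ , m , x∈B)))
      (All.all? (λ (A , B) → x ∈? B →-dec any? (λ t → t ∈? T ×-dec t ∈? A)) Σ')

    edge-⊈-closed : ∀ {M A} → Closed Σ' M → x ∉ M → Edge Σ' x A → ∃[ t ] (t ∈ A × t ∉ M)
    edge-⊈-closed {M} {A} M-closed x∉M (B , m , x∈B) with any? (λ t → t ∈? A ×-dec ¬? (t ∈? M))
    ... | yes witness = witness
    ... | no ∄outside = contradiction (M-closed A B m A⊆M x∈B) x∉M
      where
      A⊆M : A ⊆ M
      A⊆M {t} t∈A with t ∈? M
      ... | yes t∈M = t∈M
      ... | no  t∉M = contradiction (t , t∈A , t∉M) ∄outside

    disjoint-transversal : ∀ {M} → Closed Σ' M → x ∉ M → ∃[ T ] (Transversal Σ' x T × Disjoint T M)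
    disjoint-transversal {M} M-closed x∉M =
      T , (vertices , meets) , λ v v∈T → proj₂ (∈-comprehension⁻ outside? v∈T)
      where
      outside? : Decidable (λ v → Vertex Σ' x v × v ∉ M)
      outside? v = vertex? v ×-dec ¬? (v ∈? M)

      T : Subset n
      T = comprehension outside?

      vertices : ∀ v → v ∈ T → Vertex Σ' x v
      vertices v v∈T = proj₁ (∈-comprehension⁻ outside? v∈T)

      meets : ∀ A → Edge Σ' x A → ∃[ t ] (t ∈ T × t ∈ A)
      meets A e = let t , t∈A , t∉M = edge-⊈-closed M-closed x∉M e
        in t , ∈-comprehension⁺ outside? ((A , e , t∈A) , t∉M) , t∈A

    minimal-disjoint-transversal : ∀ {M T} → Minimal (λ T → Transversal Σ' x T × Disjoint T M) T →
      MinimalTransversal Σ' x T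
    minimal-disjoint-transversal ((T-tr , T-disj) , minT) =
      T-tr , λ T′ T′⊆T T′-tr → minT T′ T′⊆T (T′-tr , λ z z∈T′ → T-disj z (T′⊆T z∈T′))

    ⋂-minus-closed : ∀ {T C} (S : Selection T) → Transversal Σ' x T →
      (∀ t (t∈T : t ∈ T) → Closed Σ' (S t t∈T) × t ∉ S t t∈T) →
      (∀ z → (z ∈ C) ⇔ (InIntersection S z × z ≢ x)) → Closed Σ' C
    ⋂-minus-closed S (_ , meets) S-closed C⇔ A B m A⊆C {b} b∈B =
      Equivalence.from (C⇔ b) (b∈⋂ , b≢x)
      where
      A⊆S : ∀ t t∈T → A ⊆ S t t∈T
      A⊆S t t∈T a∈A = proj₁ (Equivalence.to (C⇔ _) (A⊆C a∈A)) t t∈T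

      b∈⋂ : InIntersection S b
      b∈⋂ t t∈T = proj₁ (S-closed t t∈T) A B m (A⊆S t t∈T) b∈B

      b≢x : b ≢ x
      b≢x refl = let t , t∈T , t∈A = meets A (B , m , b∈B)
        in proj₂ (S-closed t t∈T) (A⊆S t t∈T t∈A)

irr-selection : (Σ' : Base n) (x : Fin n) {M T : Subset n} → Irr Σ' x M →
  Transversal Σ' x T → Disjoint T M →
  Σ[ S ∈ Selection T ]
    (IrreducibleSelection Σ' T S × (∀ z → (z ∈ M) ⇔ (InIntersection S z × z ≢ x)))
irr-selection Σ' x {M} {T} (M-closed , x∉M , M-maximal) T-tr T-disjoint = S , S-irr , M⇔
  where
  S : Selection T
  S t _ = irrAbove Σ' M-closed t

  S-irr : IrreducibleSelection Σ' T S
  S-irr t t∈T = irrAbove-irr Σ' M-closed (T-disjoint t t∈T)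

  in-C? : Decidable (λ z → InIntersection S z × z ≢ x)
  in-C? z = all? (λ t → t ∈? T →-dec z ∈? irrAbove Σ' M-closed t) ×-dec ¬? (z ≟ x)

  C : Subset _
  C = comprehension in-C?

  C⇔ : ∀ z → (z ∈ C) ⇔ (InIntersection S z × z ≢ x)
  C⇔ z = mk⇔ (∈-comprehension⁻ in-C?) (∈-comprehension⁺ in-C?)

  C-closed : Closed Σ' C
  C-closed = ⋂-minus-closed Σ' x S T-tr
    (λ t t∈T → let S-closed , t∉S , _ = S-irr t t∈T in S-closed , t∉S) C⇔

  M⊆C : M ⊆ C
  M⊆C z∈M = ∈-comprehension⁺ in-C? ((λ t _ → ⊆-irrAbove Σ' M-closed t z∈M) , λ { refl → x∉M z∈M })

  x∉C : x ∉ C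
  x∉C x∈C = proj₂ (∈-comprehension⁻ in-C? x∈C) refl

  M⇔ : ∀ z → (z ∈ M) ⇔ (InIntersection S z × z ≢ x)
  M⇔ z = C⇔ z ⇔-∘ mk⇔ M⊆C (M-maximal C C-closed x∉C M⊆C)

lemma21 : ∀ {n} (Σ' : Base n) → IsImplicationalBase Σ' → Acyclic Σ' →
    (x : Fin n) (M : Subset n) → Irr Σ' x M →
    Σ[ T ∈ Subset n ] Σ[ S ∈ Selection T ]
      (MinimalTransversal Σ' x T × IrreducibleSelection Σ' T S ×
       (∀ z → (z ∈ M) ⇔ (InIntersection S z × z ≢ x)))
lemma21 Σ' _ _ x M M-irr@(M-closed , x∉M , _) =
  let _ , _ , T-minimal@((T-tr , T-disjoint) , _) =
        minimal-⊆ (λ T → transversal? Σ' x T ×-dec disjoint? T M)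
                  (proj₂ (disjoint-transversal Σ' x M-closed x∉M))
      S , S-irr , M⇔ = irr-selection Σ' x M-irr T-tr T-disjoint
  in _ , S , minimal-disjoint-transversal Σ' x T-minimal , S-irr , M⇔
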